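{- Let $T$ be a finite rooted tree with root $r$, and let $id$, $a_i$, $lw$, $k$, $next$, $wc$, $rld$ be as defined in the context (ids produced by $\mathrm{AssignId}(r,0)$). For nodes $u,v$ of $T$, $u$ is the parent of $v$ if and only if either (1.1) $v$ is not an apex node, (1.2) $u$ is not a leaf, and (1.3) $id(v)$ is the smallest integer $\ge id(u)+lw(u)$ having at least $k(u)+next(u)$ trailing zeros in its binary representation; or (2.1) $v$ is an apex node, (2.2) $wc(v)\le wc(u)$, (2.3) $id(v)\in\bigl(id(u)+a_{wc(v)-1}(u),\ id(u)+a_{wc(v)}(u)\bigr]$, and (2.4) if $wc(v)<wc(u)$ then $rld(v)=0$, while if $wc(v)=wc(u)$ then $rld(v)=rld(u)+1$.
   Context: For $x>0$, $\lg x=\max(1,\log_2 x)$. In a finite rooted tree $T$, $T_u$ is the subtree rooted at $u$ and $|T_u|$ its number of nodes. Heavy-light decomposition: for a non-leaf node $u$, $heavy(u)$ is a child $v$ of $u$ maximizing $|T_v|$ (one fixed choice); the edge $(u,heavy(u))$ is heavy, the other children of $u$ are its light children (edges to them are light). A node is an apex node if it is the root or the edge to its parent is light. The light subtree is $T_u^\ell=T_u\setminus T_{heavy(u)}$ (for a leaf, $T_u^\ell=\{u\}$). A heavy path is a maximal path $(u_1,\ldots,u_t)$ with $u_{i+1}=heavy(u_i)$; $u_1$ is apex and every node lies on exactly one heavy path. Define $\gamma(u)=\lfloor\lg|T_u|\rfloor$ if $u$ is apex and $\gamma(u)=\lfloor\lg|T_u^\ell|\rfloor$ otherwise, and $wc(u)=\lfloor\lg\gamma(u)\rfloor$.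 Let $wtop(u)$ be the ancestor of $u$ (possibly $u$) of smallest depth such that every node on the path from $u$ to it has weight class $\le wc(u)$; $rld(u)$ is the number of light edges on the path from $u$ to $wtop(u)$. A $(1+\varepsilon)$-approximation of a non-negative number $a$ is a number $b$ with $a\le b<(1+\varepsilon)a$ ($b=0$ if $a=0$). Weights (recursive): for a node $u$ and $1\le i\le wc(u)$, $b_i(u)=\sum pw(v)$ over light children $v$ of $u$ with $wc(v)=i$; $a_0(u)=0$ and $a_i(u)$ is a $(1+\gamma(u)^{ -3})$-approximation of $a_{i-1}(u)+b_i(u)$ for $i=1,\ldots,wc(u)$; $lw(u)=1+a_{wc(u)}(u)$. For a heavy path $(u_1,\ldots,u_t)$: $k'(u_i)=\gamma(u_i)-\lceil2\lg\gamma(u_i)\rceil+1$, $k(u_i)=\max_{1\le j\le t}(k'(u_j)-|i-j|)$, $pw(u_1)=\sum_{i=1}^t(lw(u_i)+2^{k(u_i)}-1)$. Ids: the procedure $\mathrm{AssignId}(u,s)$ sets $id(u)$ to the unique integer in $[s,s+2^{k(u)}-1]$ with at least $k(u)$ trailing zeros in binary; then for $i=1,\ldots,wc(u)$ in increasing order, with $v_1,\ldots,v_m$ the light children of $u$ of weight class $i$ (in order of subtree size), it sets $t_1=id(u)+a_{i-1}(u)+1$ and for $j=1,\ldots,m$ calls $\mathrm{AssignId}(v_j,t_j)$ and sets $t_{j+1}=t_j+pw(v_j)$; finally, if $u$ is not a leaf, it calls $\mathrm{AssignId}(heavy(u),id(u)+lw(u))$. Ids are assigned by calling $\mathrm{AssignId}(r,0)$.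 Finally $next(u)=k(heavy(u))-k(u)\in\{ -1,0,1\}$ if $u$ is not a leaf, and $next(u)=0$ if $u$ is a leaf. -}

module Defs where

open import Data.Nat using (ℕ; zero; suc; _+_; _*_; _∸_; _^_; _≤_; _<_; _⊔_; ∣_-_∣; _≟_; _≤?_; _<?_)
open import Data.Nat.DivMod using (_/_)
open import Data.Nat.Properties using (m^n≢0)
open import Data.Nat.Logarithm using (⌊log₂_⌋; ⌈log₂_⌉)
open import Data.Nat.Divisibility using (_∣_)
open import Data.Integer as ℤ using (ℤ; +_; ∣_∣)
open import Data.Fin as Fin using (Fin; toℕ)
open import Data.Nat.ListAction using (sum)
open import Data.List using (List; []; _∷_; map; filter; reverse; foldr; length; lookup; allFin)
open import Data.Bool using (Bool; true; false; if_then_else_)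
open import Data.Product using (_×_; Σ; _,_)
open import Relation.Nullary using (yes; no)
open import Data.Sum using (_⊎_)
open import Data.Unit using (⊤)
open import Relation.Binary.PropositionalEquality using (_≡_)

-- A node is either a leaf, or an internal node with a designated heavy
-- child and m light children (given as a function Fin m → HTree, in the
-- order used by AssignId).

data HTree : Set where
  leaf : HTree
  node : (h : HTree) (m : ℕ) (f : Fin m → HTree) → HTree

sumFin : (m : ℕ) → (Fin m → ℕ) → ℕ
sumFin zero    g = 0
sumFin (suc m) g = g Fin.zero + sumFin m (λ j → g (Fin.suc j))

size : HTree → ℕ
size leaf         = 1
size (node h m f) = 1 + size h + sumFin m (λ j → size (f j))

lsize : HTree → ℕ
lsize leaf         = 1
lsize (node h m f) = 1 + sumFin m (λ j → size (f j))

HLD : HTree → Set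
HLD leaf = ⊤
HLD (node h m f) =
  (∀ j → size (f j) ≤ size h) ×
  (∀ j j' → toℕ j ≤ toℕ j' → size (f j) ≤ size (f j')) ×
  HLD h × (∀ j → HLD (f j))

data Pos : HTree → Set where
  here : ∀ {t} → Pos t
  hv   : ∀ {h m f} → Pos h → Pos (node h m f)
  lt   : ∀ {h m f} (j : Fin m) → Pos (f j) → Pos (node h m f)

data _⋖_ : ∀ {t} → Pos t → Pos t → Set where
  par-hv : ∀ {h m f} → _⋖_ {node h m f} here (hv here)
  par-lt : ∀ {h m f} (j : Fin m) → _⋖_ {node h m f} here (lt j here)
  in-hv  : ∀ {h m f} {u v : Pos h} → u ⋖ v → _⋖_ {node h m f} (hv u) (hv v)
  in-lt  : ∀ {h m f} (j : Fin m) {u v : Pos (f j)} → u ⋖ v →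
           _⋖_ {node h m f} (lt j u) (lt j v)

sub : ∀ {t} → Pos t → HTree
sub {t} here = t
sub (hv p)   = sub p
sub (lt j p) = sub p

emb : ∀ {t} (p : Pos t) → Pos (sub p) → Pos t
emb here     q = q
emb (hv p)   q = hv (emb p q)
emb (lt j p) q = lt j (emb p q)

isLeaf : HTree → Bool
isLeaf leaf = true
isLeaf (node _ _ _) = false

apxIn : ∀ {t} → Bool → Pos t → Bool
apxIn b here     = b
apxIn b (hv p)   = apxIn false p
apxIn b (lt j p) = apxIn true p

apx : ∀ {t} → Pos t → Bool
apx = apxIn true

heavyAux : ∀ {t} (s : HTree) → (Pos s → Pos t) → List (Pos t)
heavyAux leaf         e = []
heavyAux (node h m f) e = e (hv here) ∷ []

lightAux : ∀ {t} (s : HTree) → (Pos s → Pos t) → List (Pos t)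
lightAux leaf         e = []
lightAux (node h m f) e = map (λ j → e (lt j here)) (allFin m)

heavyKid : ∀ {t} → Pos t → List (Pos t)      -- [] for a leaf
heavyKid p = heavyAux (sub p) (emb p)

lightKids : ∀ {t} → Pos t → List (Pos t)
lightKids p = lightAux (sub p) (emb p)

hpathHere : (s : HTree) → List (Pos s)
hpathHere leaf         = here ∷ []
hpathHere (node h m f) = here ∷ map hv (hpathHere h)

hpathFrom : ∀ {t} → Pos t → List (Pos t)
hpathFrom p = map (emb p) (hpathHere (sub p))

pathTo : ∀ {t} → Pos t → List (Pos t)
pathTo here     = here ∷ []
pathTo (hv p)   = here ∷ map hv (pathTo p)
pathTo (lt j p) = here ∷ map (lt j) (pathTo p)

-- Logarithms.  lg x = max(1, log₂ x);  for a natural x ≥ 1,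
-- ⌊lg x⌋ = max(1, ⌊log₂ x⌋) and ⌈2 lg x⌉ = max(2, ⌈log₂ (x²)⌉).

flg : ℕ → ℕ
flg x = 1 ⊔ ⌊log₂ x ⌋

c2lg : ℕ → ℕ
c2lg x = 2 ⊔ ⌈log₂ (x * x) ⌉

γ' : Bool → HTree → ℕ
γ' true  s = flg (size s)
γ' false s = flg (lsize s)

γ : ∀ {t} → Pos t → ℕ
γ p = γ' (apx p) (sub p)

wc : ∀ {t} → Pos t → ℕ
wc p = flg (γ p)

k' : ℕ → ℕ
k' g = g + 1 ∸ c2lg g

kps : HTree → List ℕ
kps s = go true s
  where
  go : Bool → HTree → List ℕ
  go b leaf           = k' (γ' b leaf) ∷ []
  go b t@(node h m f) = k' (γ' b t) ∷ go false h

maxL : List ℕ → ℕ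
maxL = foldr _⊔_ 0

-- k(u_i) = max_j (k'(u_j) - |i-j|)   (i, j counted from 0 here)
kPath : HTree → ℕ → ℕ
kPath s i = maxL (go 0 (kps s))
  where
  go : ℕ → List ℕ → List ℕ
  go j []       = []
  go j (x ∷ xs) = (x ∸ ∣ i - j ∣) ∷ go (suc j) xs

kIn : (t : HTree) → (ℕ → ℕ) → Pos t → ℕ
kIn t            kf here     = kf 0
kIn (node h m f) kf (hv p)   = kIn h (λ i → kf (suc i)) p
kIn (node h m f) kf (lt j p) = kIn (f j) (kPath (f j)) p

kOf : ∀ {t} → Pos t → ℕ
kOf {t} = kIn t (kPath t)

nextAux : ∀ {t} → Pos t → List (Pos t) → ℤ
nextAux u []      = + 0
nextAux u (h ∷ _) = + kOf h ℤ.- + kOf u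

next : ∀ {t} → Pos t → ℤ
next u = nextAux u (heavyKid u)

-- Weights, given the chosen approximations A u i = a_i(u).

module Weights {T : HTree} (A : Pos T → ℕ → ℕ) where

  lw : Pos T → ℕ
  lw u = 1 + A u (wc u)

  pw : Pos T → ℕ
  pw p = sum (map (λ u → lw u + 2 ^ kOf u ∸ 1) (hpathFrom p))

  b : Pos T → ℕ → ℕ
  b u i = sum (map pw (filter (λ v → wc v ≟ i) (lightKids u)))

-- (1+γ^{-3})-approximation: a ≤ x < (1 + g^{-3}) a, and x = 0 if a = 0
Approx : (g a x : ℕ) → Set
Approx g a x = (a ≡ 0 × x ≡ 0) ⊎
               (0 < a × a ≤ x × x * g ^ 3 < a * g ^ 3 + a)

ValidA : (T : HTree) → (Pos T → ℕ → ℕ) → Set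
ValidA T A = ∀ (u : Pos T) → A u 0 ≡ 0 ×
  (∀ i → 1 ≤ i → i ≤ wc u → Approx (γ u) (A u (i ∸ 1) + Weights.b A u i) (A u i))

-- the unique integer in [s, s + 2^k - 1] with ≥ k trailing zeros
roundUp : ℕ → ℕ → ℕ
roundUp s k = _/_ (s + 2 ^ k ∸ 1) (2 ^ k) {{m^n≢0 2 k}} * 2 ^ k

module Ids {T : HTree} (A : Pos T → ℕ → ℕ) where
  open Weights A

  before : ∀ {h m f} → (Pos (node h m f) → Pos T) → Fin m → ℕ → ℕ
  before {m = m} e j i =
    sum (map (λ j' → pw (e (lt j' here)))
      (filter (λ j' → wc (e (lt j' here)) ≟ i)
        (filter (λ j' → toℕ j' <? toℕ j) (allFin m))))

  idIn : (t : HTree) → ℕ → (Pos t → Pos T) → Pos t → ℕ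
  idIn t s e here = roundUp s (kOf (e here))
  idIn (node h m f) s e (hv p) =
    idIn h (idIn (node h m f) s e here + lw (e here)) (λ q → e (hv q)) p
  idIn (node h m f) s e (lt j p) =
    idIn (f j)
      (idIn (node h m f) s e here + A (e here) (i ∸ 1) + 1 + before e j i)
      (λ q → e (lt j q)) p
    where i = wc (e (lt j here))

  id : Pos T → ℕ
  id = idIn T 0 (λ q → q)

-- rld(u): number of light edges on the path from u up to wtop(u).
-- The argument list is (wc(x), apex(x)) for x = u, parent(u), ..., root;
-- the edge from x to its parent is light iff x is apex (x ≠ root).

-- rldL c b xs : b = apex flag of the current node x, xs = (wc, apex) of
-- the proper ancestors of x, nearest first.
rldL : ℕ → Bool → List (ℕ × Bool) → ℕ
rldL c bb [] = 0
rldL c bb ((w' , bb') ∷ rest) with w' ≤? c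
... | yes _ = (if bb then 1 else 0) + rldL c bb' rest
... | no  _ = 0

rld : ∀ {t} → Pos t → ℕ
rld u = go (map (λ x → wc x , apx x) (reverse (pathTo u)))
  where
  go : List (ℕ × Bool) → ℕ
  go [] = 0
  go ((_ , bb) ∷ xs) = rldL (wc u) bb xs

SmallestTZ : (y x n : ℕ) → Set
SmallestTZ y x n = x ≤ y × 2 ^ n ∣ y × (∀ z → x ≤ z → 2 ^ n ∣ z → y ≤ z)

-- AssignId(u, s) gives the subtree of an apex node u ids in [s, s + pw(u)).
-- Within it, the block [id u, id u + lw u) of any node u holds the ranges of the
-- light subtrees of u, pairwise disjoint and, for class i, inside
-- (id u + a_{i-1}(u), id u + a_i(u)]; the heavy subtree of u starts at the first
-- multiple of 2^k(heavy u) beyond the block.  Hence ids are injective, a heavy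
-- child is pinned down by the round-up rule (1.3), and a light child satisfies
-- (2.3).  Conversely, a node v satisfying (2.3) lies in the block of u, hence in
-- the subtree of a light child w of u of the same class as v; if v ≠ w, the light
-- edges into w and into v both count towards rld v, contradicting (2.4).
module Submission where

open import Defs
open import Data.Nat using (ℕ; zero; suc; _+_; _*_; _∸_; _^_; _≤_; _<_; _≟_; _≤?_; _<?_; z≤n; s≤s; s≤s⁻¹)
open import Data.Nat.Properties
open import Data.Nat.DivMod using (_/_; _%_; m/n*n≤m; m%n<n; m≡m%n+[m/n]*n; m<n*o⇒m/o<n)
open import Data.Nat.Divisibility using (divides; n∣m*n)
open import Data.Nat.ListAction using (sum)
open import Data.Nat.Logarithm using (⌊log₂_⌋; ⌊log₂⌋-mono-≤)
open import Data.Nat.Tactic.RingSolver using (solve-∀)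
open import Data.Integer using (+_; ∣_∣) renaming (_+_ to _+ℤ_)
import Data.Integer as ℤ
import Data.Integer.Tactic.RingSolver as ℤ-Solver
open import Data.Bool using (Bool; true; false; if_then_else_)
open import Data.List using (List; []; _∷_; map; filter; reverse; _∷ʳ_; allFin)
open import Data.List.Properties using (map-∘; map-id; map-++; reverse-++)
open import Data.List.Relation.Unary.Any using (here; there)
open import Data.List.Membership.Propositional using (_∈_)
open import Data.List.Membership.Propositional.Properties using (∈-allFin)
open import Data.Fin as Fin using (Fin; toℕ)
open import Data.Fin.Properties using (toℕ-injective)
open import Data.Product using (_×_; _,_; ∃; proj₁; proj₂)
open import Data.Sum as Sum using (_⊎_; inj₁; inj₂)
open import Data.Empty using (⊥; ⊥-elim)
open import Level using (0ℓ)
open import Relation.Nullary using (yes; no; ¬_)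
open import Relation.Nullary.Negation using (contradiction)
open import Relation.Unary using (Pred; Decidable; _⊆_)
open import Relation.Unary.Properties using (_∩?_)
open import Relation.Binary using (tri<; tri≈; tri>)
open import Relation.Binary.PropositionalEquality

roundUp-≤ : ∀ s k → roundUp s k ≤ s + (2 ^ k ∸ 1)
roundUp-≤ s k = begin
  roundUp s k         ≤⟨ m/n*n≤m (s + 2 ^ k ∸ 1) (2 ^ k) ⟩
  s + 2 ^ k ∸ 1       ≡⟨ +-∸-assoc s (m^n>0 2 k) ⟩
  s + (2 ^ k ∸ 1)     ∎
  where
  open ≤-Reasoning
  instance _ = m^n≢0 2 k

roundUp-≥ : ∀ s k → s ≤ roundUp s k
roundUp-≥ s k = +-cancelʳ-≤ (N ∸ 1) s (roundUp s k) (begin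
  s + (N ∸ 1)                  ≡⟨ +-∸-assoc s (m^n>0 2 k) ⟨
  x                            ≡⟨ m≡m%n+[m/n]*n x N ⟩
  x % N + roundUp s k          ≤⟨ +-monoˡ-≤ (roundUp s k) (<⇒≤pred (m%n<n x N)) ⟩
  (N ∸ 1) + roundUp s k        ≡⟨ +-comm (N ∸ 1) (roundUp s k) ⟩
  roundUp s k + (N ∸ 1)        ∎)
  where
  open ≤-Reasoning
  N = 2 ^ k
  x = s + N ∸ 1
  instance _ = m^n≢0 2 k

roundUp-least : ∀ s k d → s ≤ d * 2 ^ k → roundUp s k ≤ d * 2 ^ k
roundUp-least s k d s≤dN = *-monoˡ-≤ N {(s + N ∸ 1) / N} {d} (<⇒≤pred (m<n*o⇒m/o<n x<[1+d]N))
  where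
  N = 2 ^ k
  instance _ = m^n≢0 2 k
  x<[1+d]N : s + N ∸ 1 < suc d * N
  x<[1+d]N = begin-strict
    s + N ∸ 1       ≡⟨ +-∸-assoc s (m^n>0 2 k) ⟩
    s + (N ∸ 1)     <⟨ +-mono-≤-< s≤dN (∸-monoʳ-< {n = 1} (s≤s z≤n) (m^n>0 2 k)) ⟩
    d * N + N       ≡⟨ +-comm (d * N) N ⟩
    suc d * N       ∎
    where open ≤-Reasoning

roundUp-smallest : ∀ s k → SmallestTZ (roundUp s k) s k
roundUp-smallest s k =
  roundUp-≥ s k , n∣m*n ((s + 2 ^ k ∸ 1) / 2 ^ k) ,
  λ { z s≤z (divides d refl) → roundUp-least s k d s≤z }
  where instance _ = m^n≢0 2 k

SmallestTZ-unique : ∀ {y y′ x n} → SmallestTZ y x n → SmallestTZ y′ x n → y ≡ y′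
SmallestTZ-unique (x≤y , ∣y , least) (x≤y′ , ∣y′ , least′) =
  ≤-antisym (least _ x≤y′ ∣y′) (least′ _ x≤y ∣y)

i+[j-i]≡j : ∀ i j → i +ℤ (j ℤ.- i) ≡ j
i+[j-i]≡j = ℤ-Solver.solve-∀

Approx⇒≤ : ∀ g {a x} → Approx g a x → a ≤ x
Approx⇒≤ g (inj₁ (refl , _))     = z≤n
Approx⇒≤ g (inj₂ (_ , a≤x , _)) = a≤x

stepwise-mono : ∀ {a : ℕ → ℕ} {n} → (∀ i → i < n → a i ≤ a (suc i)) →
                ∀ {i j} → i ≤ j → j ≤ n → a i ≤ a j
stepwise-mono step {j = zero}  z≤n  _ = ≤-refl
stepwise-mono step {j = suc j} i≤1+j 1+j≤n with m≤n⇒m<n∨m≡n i≤1+j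
... | inj₂ refl      = ≤-refl
... | inj₁ (s≤s i≤j) = ≤-trans (stepwise-mono step i≤j (≤-trans (n≤1+n j) 1+j≤n)) (step j 1+j≤n)

interval-unique : ∀ {a : ℕ → ℕ} {n} → (∀ {i j} → i ≤ j → j ≤ n → a i ≤ a j) →
                  ∀ {i j x} → i ≤ n → j ≤ n →
                  a (i ∸ 1) < x → x ≤ a i → a (j ∸ 1) < x → x ≤ a j → i ≡ j
interval-unique {a} mono {i} {j} {x} i≤n j≤n lo-i hi-i lo-j hi-j with <-cmp i j
... | tri≈ _ i≡j _ = i≡j
... | tri< i<j _ _ = ⊥-elim (<⇒≱ lo-j (≤-trans hi-i (mono (∸-monoˡ-≤ 1 i<j) (≤-trans (m∸n≤m j 1) j≤n))))
... | tri> _ _ j<i = ⊥-elim (<⇒≱ lo-i (≤-trans hi-j (mono (∸-monoˡ-≤ 1 j<i) (≤-trans (m∸n≤m i 1) i≤n))))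

module _ {X : Set} {P Q : Pred X 0ℓ} (P? : Decidable P) (Q? : Decidable Q) where

  filter-filter : ∀ xs → filter P? (filter Q? xs) ≡ filter (Q? ∩? P?) xs
  filter-filter [] = refl
  filter-filter (x ∷ xs) with Q? x
  ... | no _  = filter-filter xs
  ... | yes _ with P? x
  ...   | yes _ = cong (x ∷_) (filter-filter xs)
  ...   | no _  = filter-filter xs

filter-map : ∀ {X Y : Set} {P : Pred X 0ℓ} (P? : Decidable P) (g : Y → X) ys →
             filter P? (map g ys) ≡ map g (filter (λ y → P? (g y)) ys)
filter-map P? g [] = refl
filter-map P? g (y ∷ ys) with P? (g y)
... | yes _ = cong (g y ∷_) (filter-map P? g ys)
... | no _  = filter-map P? g ys

module _ {X : Set} (g : X → ℕ) where

  sumWhere : {P : Pred X 0ℓ} → Decidable P → List X → ℕ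
  sumWhere P? xs = sum (map g (filter P? xs))

  module _ {P Q : Pred X 0ℓ} (P? : Decidable P) (Q? : Decidable Q) (P⊆Q : P ⊆ Q) where

    sumWhere-mono : ∀ xs → sumWhere P? xs ≤ sumWhere Q? xs
    sumWhere-mono [] = ≤-refl
    sumWhere-mono (x ∷ xs) with P? x | Q? x
    ... | yes _  | yes _  = +-monoʳ-≤ (g x) (sumWhere-mono xs)
    ... | yes px | no ¬qx = contradiction (P⊆Q px) ¬qx
    ... | no _   | yes _  = ≤-trans (sumWhere-mono xs) (m≤n+m _ (g x))
    ... | no _   | no _   = sumWhere-mono xs

    sumWhere-+ : ∀ {y xs} → y ∈ xs → ¬ P y → Q y → sumWhere P? xs + g y ≤ sumWhere Q? xs
    sumWhere-+ {xs = x ∷ xs} (here refl) ¬py qy with P? x | Q? x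
    ... | yes py | _      = contradiction py ¬py
    ... | no _   | no ¬qy = contradiction qy ¬qy
    ... | no _   | yes _  = ≤-trans (≤-reflexive (+-comm _ (g x))) (+-monoʳ-≤ (g x) (sumWhere-mono xs))
    sumWhere-+ {xs = x ∷ xs} (there y∈xs) ¬py qy with P? x | Q? x
    ... | yes _  | yes _  = ≤-trans (≤-reflexive (+-assoc (g x) _ _)) (+-monoʳ-≤ (g x) (sumWhere-+ y∈xs ¬py qy))
    ... | yes px | no ¬qx = contradiction (P⊆Q px) ¬qx
    ... | no _   | yes _  = ≤-trans (sumWhere-+ y∈xs ¬py qy) (m≤n+m _ (g x))
    ... | no _   | no _   = sumWhere-+ y∈xs ¬py qy

≤-sumFin : ∀ m (g : Fin m → ℕ) j → g j ≤ sumFin m g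
≤-sumFin (suc m) g Fin.zero    = m≤m+n _ _
≤-sumFin (suc m) g (Fin.suc j) = ≤-trans (≤-sumFin m (λ i → g (Fin.suc i)) j) (m≤n+m _ _)

lsize≤size : ∀ s → lsize s ≤ size s
lsize≤size leaf         = ≤-refl
lsize≤size (node h m f) = s≤s (m≤n+m _ (size h))

flg-mono : ∀ {a b} → a ≤ b → flg a ≤ flg b
flg-mono p = ⊔-monoʳ-≤ 1 (⌊log₂⌋-mono-≤ p)

γ'≤flg-size : ∀ b s → γ' b s ≤ flg (size s)
γ'≤flg-size true  s = ≤-refl
γ'≤flg-size false s = flg-mono (lsize≤size s)

flg-lsize≤γ' : ∀ b s → flg (lsize s) ≤ γ' b s
flg-lsize≤γ' true  s = flg-mono (lsize≤size s)
flg-lsize≤γ' false s = ≤-refl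

variable
  t : HTree
  u v w x y : Pos t

size-⋖ : u ⋖ v → size (sub v) ≤ size (sub u)
size-⋖ par-hv = ≤-trans (m≤m+n _ _) (n≤1+n _)
size-⋖ (par-lt {h} {m} {f} j) =
  ≤-trans (≤-sumFin m (λ i → size (f i)) j) (≤-trans (m≤n+m _ (size h)) (n≤1+n _))
size-⋖ (in-hv p)   = size-⋖ p
size-⋖ (in-lt j p) = size-⋖ p

size-light-⋖ : ∀ b → u ⋖ v → apxIn b v ≡ true → size (sub v) ≤ lsize (sub u)
size-light-⋖ b par-hv ()
size-light-⋖ b (par-lt {m = m} {f} j) _ =
  ≤-trans (≤-sumFin m (λ i → size (f i)) j) (n≤1+n _)
size-light-⋖ b (in-hv p)   = size-light-⋖ false p
size-light-⋖ b (in-lt j p) = size-light-⋖ true p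

wc-light-⋖ : u ⋖ v → apx v ≡ true → wc v ≤ wc u
wc-light-⋖ {u = u} {v = v} p av = flg-mono (begin
  γ v                      ≡⟨ cong (λ b → γ' b (sub v)) av ⟩
  flg (size (sub v))       ≤⟨ flg-mono (size-light-⋖ true p av) ⟩
  flg (lsize (sub u))      ≤⟨ flg-lsize≤γ' (apx u) (sub u) ⟩
  γ u                      ∎)
  where open ≤-Reasoning

data _⋖*_ {t} : Pos t → Pos t → Set where
  ε   : x ⋖* x
  _▸_ : x ⋖* y → y ⋖ v → x ⋖* v

infixl 5 _▸_

⋖*-map : ∀ {t t′} (g : Pos t → Pos t′) → (∀ {a b} → a ⋖ b → g a ⋖ g b) →
         ∀ {x y} → x ⋖* y → g x ⋖* g y
⋖*-map g g-⋖ ε       = ε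
⋖*-map g g-⋖ (c ▸ p) = ⋖*-map g g-⋖ c ▸ g-⋖ p

⋖-⋖* : x ⋖ y → y ⋖* v → x ⋖* v
⋖-⋖* p ε       = ε ▸ p
⋖-⋖* p (c ▸ q) = ⋖-⋖* p c ▸ q

here-⋖* : ∀ (v : Pos t) → here ⋖* v
here-⋖* here     = ε
here-⋖* (hv v)   = ⋖-⋖* par-hv (⋖*-map hv in-hv (here-⋖* v))
here-⋖* (lt j v) = ⋖-⋖* (par-lt j) (⋖*-map (lt j) (in-lt j) (here-⋖* v))

hv-⋖*⁻¹ : ∀ {h m f} {x : Pos h} {v : Pos (node h m f)} → hv x ⋖* v → ∃ λ y → v ≡ hv y × x ⋖* y
hv-⋖*⁻¹ ε = _ , refl , ε
hv-⋖*⁻¹ (c ▸ p) with hv-⋖*⁻¹ c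
... | _ , refl , c′ with p
... | in-hv p′ = _ , refl , c′ ▸ p′

lt-⋖*⁻¹ : ∀ {h m f j} {x : Pos (f j)} {v : Pos (node h m f)} → lt j x ⋖* v → ∃ λ y → v ≡ lt j y × x ⋖* y
lt-⋖*⁻¹ ε = _ , refl , ε
lt-⋖*⁻¹ (c ▸ p) with lt-⋖*⁻¹ c
... | _ , refl , c′ with p
... | in-lt j p′ = _ , refl , c′ ▸ p′

wc-⋖* : x ⋖* y → apx x ≡ true → wc y ≤ wc x
wc-⋖* {x = x} {y = y} c ax = flg-mono (begin
  γ y                 ≤⟨ γ'≤flg-size (apx y) (sub y) ⟩
  flg (size (sub y))  ≤⟨ flg-mono (size-⋖* c) ⟩
  flg (size (sub x))  ≡⟨ cong (λ b → γ' b (sub x)) ax ⟨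
  γ x                 ∎)
  where
  open ≤-Reasoning
  size-⋖* : ∀ {x y : Pos t} → x ⋖* y → size (sub y) ≤ size (sub x)
  size-⋖* ε       = ≤-refl
  size-⋖* (c ▸ p) = ≤-trans (size-⋖ p) (size-⋖* c)

data _⋖ₕ_ : Pos t → Pos t → Set where
  hv-here : ∀ {h m f} → _⋖ₕ_ {node h m f} here (hv here)
  hv-hv   : ∀ {h m f} {u v : Pos h} → u ⋖ₕ v → _⋖ₕ_ {node h m f} (hv u) (hv v)
  hv-lt   : ∀ {h m f} (j : Fin m) {u v : Pos (f j)} → u ⋖ₕ v → _⋖ₕ_ {node h m f} (lt j u) (lt j v)

⋖ₕ⇒⋖ : u ⋖ₕ v → u ⋖ v
⋖ₕ⇒⋖ hv-here     = par-hv
⋖ₕ⇒⋖ (hv-hv e)   = in-hv (⋖ₕ⇒⋖ e)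
⋖ₕ⇒⋖ (hv-lt j e) = in-lt j (⋖ₕ⇒⋖ e)

⋖⇒⋖ₕ : ∀ b → u ⋖ v → apxIn b v ≡ false → u ⋖ₕ v
⋖⇒⋖ₕ b par-hv      _  = hv-here
⋖⇒⋖ₕ b (par-lt j)  ()
⋖⇒⋖ₕ b (in-hv p)   av = hv-hv (⋖⇒⋖ₕ false p av)
⋖⇒⋖ₕ b (in-lt j p) av = hv-lt j (⋖⇒⋖ₕ true p av)

heavyAux-∘ : ∀ {t t′} (g : Pos t → Pos t′) s (e : Pos s → Pos t) →
             heavyAux s (λ q → g (e q)) ≡ map g (heavyAux s e)
heavyAux-∘ g leaf         e = refl
heavyAux-∘ g (node h m f) e = refl

lightAux-∘ : ∀ {t t′} (g : Pos t → Pos t′) s (e : Pos s → Pos t) →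
             lightAux s (λ q → g (e q)) ≡ map g (lightAux s e)
lightAux-∘ g leaf         e = refl
lightAux-∘ g (node h m f) e = map-∘ (allFin m)

heavyKid-⋖ₕ : u ⋖ₕ v → heavyKid u ≡ v ∷ []
heavyKid-⋖ₕ hv-here = refl
heavyKid-⋖ₕ {u = hv u} (hv-hv e) =
  trans (heavyAux-∘ hv (sub u) (emb u)) (cong (map hv) (heavyKid-⋖ₕ e))
heavyKid-⋖ₕ {u = lt j u} (hv-lt j e) =
  trans (heavyAux-∘ (lt j) (sub u) (emb u)) (cong (map (lt j)) (heavyKid-⋖ₕ e))

heavyKid-[]⊎⋖ₕ : ∀ (u : Pos t) → heavyKid u ≡ [] ⊎ ∃ (u ⋖ₕ_)
heavyKid-[]⊎⋖ₕ {leaf}       here = inj₁ refl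
heavyKid-[]⊎⋖ₕ {node h m f} here = inj₂ (hv here , hv-here)
heavyKid-[]⊎⋖ₕ (hv u) with heavyKid-[]⊎⋖ₕ u
... | inj₁ e       = inj₁ (trans (heavyAux-∘ hv (sub u) (emb u)) (cong (map hv) e))
... | inj₂ (w , e) = inj₂ (hv w , hv-hv e)
heavyKid-[]⊎⋖ₕ (lt j u) with heavyKid-[]⊎⋖ₕ u
... | inj₁ e       = inj₁ (trans (heavyAux-∘ (lt j) (sub u) (emb u)) (cong (map (lt j)) e))
... | inj₂ (w , e) = inj₂ (lt j w , hv-lt j e)

rldFrom : ℕ → List (ℕ × Bool) → ℕ
rldFrom c []             = 0
rldFrom c ((_ , b) ∷ xs) = rldL c b xs

ancestry : Pos t → List (ℕ × Bool)
ancestry z = map (λ x → wc x , apx x) (reverse (pathTo z))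

rldAt : ℕ → Pos t → ℕ
rldAt c z = rldFrom c (ancestry z)

rld≡rldAt : ∀ (z : Pos t) → rld z ≡ rldAt (wc z) z
rld≡rldAt z with ancestry z
... | []    = refl
... | _ ∷ _ = refl

pathTo-⋖ : u ⋖ v → pathTo v ≡ pathTo u ∷ʳ v
pathTo-⋖ par-hv     = refl
pathTo-⋖ (par-lt j) = refl
pathTo-⋖ {u = hv u} {v = hv v} (in-hv p) =
  cong (here ∷_) (trans (cong (map hv) (pathTo-⋖ p)) (map-++ hv (pathTo u) (v ∷ [])))
pathTo-⋖ {u = lt j u} {v = lt j v} (in-lt j p) =
  cong (here ∷_) (trans (cong (map (lt j)) (pathTo-⋖ p)) (map-++ (lt j) (pathTo u) (v ∷ [])))

ancestry-⋖ : u ⋖ v → ancestry v ≡ (wc v , apx v) ∷ ancestry u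
ancestry-⋖ {u = u} {v = v} p =
  cong (map _) (trans (cong reverse (pathTo-⋖ p)) (reverse-++ (pathTo u) (v ∷ [])))

ancestry-head : ∀ (u : Pos t) → ∃ λ L → ancestry u ≡ (wc u , apx u) ∷ L
ancestry-head u = go (here-⋖* u)
  where
  go : ∀ {u} → here ⋖* u → ∃ λ L → ancestry u ≡ (wc u , apx u) ∷ L
  go ε                 = [] , refl
  go (_▸_ {y = y} _ p) = ancestry y , ancestry-⋖ p

lightBit : Bool → ℕ
lightBit b = if b then 1 else 0

rldAt-⋖ : ∀ {c} → u ⋖ v → wc u ≤ c → rldAt c v ≡ lightBit (apx v) + rldAt c u
rldAt-⋖ {u = u} {c = c} p wcu≤c with ancestry-head u
... | L , eq rewrite ancestry-⋖ p | eq with wc u ≤? c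
... | yes _      = refl
... | no wcu≰c   = contradiction wcu≤c wcu≰c

rldAt-⋖-reset : ∀ {c} → u ⋖ v → c < wc u → rldAt c v ≡ 0
rldAt-⋖-reset {u = u} {c = c} p c<wcu with ancestry-head u
... | L , eq rewrite ancestry-⋖ p | eq with wc u ≤? c
... | yes wcu≤c = contradiction wcu≤c (<⇒≱ c<wcu)
... | no _      = refl

rldAt-mono-⋖* : ∀ {c} → w ⋖* v → apx w ≡ true → wc w ≤ c → rldAt c w ≤ rldAt c v
rldAt-mono-⋖* ε        _  _     = ≤-refl
rldAt-mono-⋖* (wy ▸ yv) aw wcw≤c rewrite rldAt-⋖ yv (≤-trans (wc-⋖* wy aw) wcw≤c) =
  ≤-trans (rldAt-mono-⋖* wy aw wcw≤c) (m≤n+m _ _)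

rld-light-⋖ : u ⋖ v → apx v ≡ true →
              (wc v < wc u → rld v ≡ 0) × (wc v ≡ wc u → rld v ≡ rld u + 1)
rld-light-⋖ {u = u} {v = v} p av = reset , step
  where
  reset : wc v < wc u → rld v ≡ 0
  reset wcv<wcu = trans (rld≡rldAt v) (rldAt-⋖-reset p wcv<wcu)
  step : wc v ≡ wc u → rld v ≡ rld u + 1
  step wcv≡wcu = begin
    rld v                              ≡⟨ rld≡rldAt v ⟩
    rldAt (wc v) v                     ≡⟨ rldAt-⋖ p (≤-reflexive (sym wcv≡wcu)) ⟩
    lightBit (apx v) + rldAt (wc v) u  ≡⟨ cong (λ b → lightBit b + rldAt (wc v) u) av ⟩
    suc (rldAt (wc v) u)               ≡⟨ cong (λ c → suc (rldAt c u)) wcv≡wcu ⟩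
    suc (rldAt (wc u) u)               ≡⟨ cong suc (rld≡rldAt u) ⟨
    suc (rld u)                        ≡⟨ +-comm 1 (rld u) ⟩
    rld u + 1                          ∎
    where open ≡-Reasoning

-- Walking up from v, the apex nodes v and w have class ≤ wc v, so rld v ≥ 1,
-- and rld v ≥ rld u + 2 when wc v = wc u.
rld-light-descendant : u ⋖ w → apx w ≡ true → w ⋖* y → y ⋖ v → apx v ≡ true → wc v ≡ wc w →
                       (wc v < wc u → rld v ≡ 0) → (wc v ≡ wc u → rld v ≡ rld u + 1) → ⊥
rld-light-descendant {u = u} {w = w} {y = y} {v = v} uw aw wy yv av wcv≡wcw reset step =
  mismatch (m≤n⇒m<n∨m≡n (≤-trans (≤-reflexive wcv≡wcw) (wc-light-⋖ uw aw)))
  where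
  open ≤-Reasoning
  c = wc v
  rld-v : rld v ≡ suc (rldAt c y)
  rld-v = begin-equality
    rld v                        ≡⟨ rld≡rldAt v ⟩
    rldAt c v                    ≡⟨ rldAt-⋖ yv (≤-trans (wc-⋖* wy aw) (≤-reflexive (sym wcv≡wcw))) ⟩
    lightBit (apx v) + rldAt c y ≡⟨ cong (λ b → lightBit b + rldAt c y) av ⟩
    suc (rldAt c y)              ∎
  mismatch : wc v < wc u ⊎ wc v ≡ wc u → ⊥
  mismatch (inj₁ wcv<wcu) = 0≢1+n (trans (sym (reset wcv<wcu)) rld-v)
  mismatch (inj₂ wcv≡wcu) = <-irrefl refl (begin-strict
    rld v                        ≡⟨ step wcv≡wcu ⟩
    rld u + 1                    ≡⟨ +-comm (rld u) 1 ⟩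
    suc (rld u)                  ≡⟨ cong suc (trans (rld≡rldAt u) (cong (λ c → rldAt c u) (sym wcv≡wcu))) ⟩
    suc (rldAt c u)              ≡⟨ cong (λ b → lightBit b + rldAt c u) aw ⟨
    lightBit (apx w) + rldAt c u ≡⟨ rldAt-⋖ uw (≤-reflexive (sym wcv≡wcu)) ⟨
    rldAt c w                    <⟨ s≤s (rldAt-mono-⋖* wy aw (≤-reflexive (sym wcv≡wcw))) ⟩
    suc (rldAt c y)              ≡⟨ rld-v ⟨
    rld v                        ∎)

-- AssignId recurses through subtrees t of T placed there by some e (idIn t s e).
record Embeds {s t : HTree} (e : Pos s → Pos t) : Set where
  field
    hpathFrom-e : ∀ q → hpathFrom (e q) ≡ map e (hpathFrom q)
    lightKids-e : ∀ q → lightKids (e q) ≡ map e (lightKids q)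
    ⋖-e         : ∀ {q q′} → q ⋖ q′ → e q ⋖ e q′
    apxIn-e     : ∀ b q → apxIn b (e q) ≡ apxIn (apxIn b (e here)) q
open Embeds

embeds-id : Embeds {t} (λ q → q)
embeds-id = record
  { hpathFrom-e = λ q → sym (map-id _)
  ; lightKids-e = λ q → sym (map-id _)
  ; ⋖-e         = λ p → p
  ; apxIn-e     = λ b q → refl
  }

embeds-∘ : ∀ {r s t} {e : Pos s → Pos t} {g : Pos r → Pos s} → Embeds e → Embeds g → Embeds (λ q → e (g q))
embeds-∘ {e = e} {g} E G = record
  { hpathFrom-e = λ q → trans (hpathFrom-e E (g q)) (trans (cong (map e) (hpathFrom-e G q)) (sym (map-∘ _)))
  ; lightKids-e = λ q → trans (lightKids-e E (g q)) (trans (cong (map e) (lightKids-e G q)) (sym (map-∘ _)))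
  ; ⋖-e         = λ p → ⋖-e E (⋖-e G p)
  ; apxIn-e     = λ b q → trans (apxIn-e E b (g q))
                    (trans (apxIn-e G _ q) (cong (λ c → apxIn c q) (sym (apxIn-e E b (g here)))))
  }

embeds-hv : ∀ {h m f} → Embeds {h} {node h m f} hv
embeds-hv = record
  { hpathFrom-e = λ q → map-∘ (hpathHere (sub q))
  ; lightKids-e = λ q → lightAux-∘ hv (sub q) (emb q)
  ; ⋖-e         = in-hv
  ; apxIn-e     = λ b q → refl
  }

embeds-lt : ∀ {h m f} j → Embeds {f j} {node h m f} (lt j)
embeds-lt j = record
  { hpathFrom-e = λ q → map-∘ (hpathHere (sub q))
  ; lightKids-e = λ q → lightAux-∘ (lt j) (sub q) (emb q)
  ; ⋖-e         = in-lt j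
  ; apxIn-e     = λ b q → refl
  }

module Layout {T : HTree} (A : Pos T → ℕ → ℕ) (VA : ValidA T A) where
  open Weights A
  open Ids A

  A-step : ∀ x i → 1 ≤ i → i ≤ wc x → A x (i ∸ 1) + b x i ≤ A x i
  A-step x i 1≤i i≤wc = Approx⇒≤ (γ x) (proj₂ (VA x) i 1≤i i≤wc)

  A-mono : ∀ x {i j} → i ≤ j → j ≤ wc x → A x i ≤ A x j
  A-mono x = stepwise-mono (λ i i<wc → ≤-trans (m≤m+n _ _) (A-step x (suc i) (s≤s z≤n) i<wc))

  slot : Pos T → ℕ
  slot x = lw x + 2 ^ kOf x ∸ 1

  pathSlots : (t : HTree) → (Pos t → Pos T) → ℕ
  pathSlots t e = sum (map (λ q → slot (e q)) (hpathHere t))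

  pw≡pathSlots : ∀ {t} {e : Pos t → Pos T} → Embeds e → pw (e here) ≡ pathSlots t e
  pw≡pathSlots {t} {e} E = begin
    sum (map slot (hpathFrom (e here)))          ≡⟨ cong (λ qs → sum (map slot qs)) (hpathFrom-e E here) ⟩
    sum (map slot (map e (map (λ q → q) (hpathHere t))))
                                                 ≡⟨ cong (λ qs → sum (map slot (map e qs))) (map-id (hpathHere t)) ⟩
    sum (map slot (map e (hpathHere t)))         ≡⟨ cong sum (map-∘ (hpathHere t)) ⟨
    pathSlots t e                                ∎
    where open ≡-Reasoning

  pathSlots-node : ∀ {h m f} (e : Pos (node h m f) → Pos T) →
                   pathSlots (node h m f) e ≡ slot (e here) + pathSlots h (λ q → e (hv q))
  pathSlots-node {h} e = cong (λ n → slot (e here) + n) (cong sum (sym (map-∘ (hpathHere h))))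

  slot≤pathSlots : ∀ t e → slot (e here) ≤ pathSlots t e
  slot≤pathSlots leaf         e = m≤m+n _ _
  slot≤pathSlots (node h m f) e = ≤-trans (m≤m+n _ _) (≤-reflexive (sym (pathSlots-node e)))

  roundUp+lw≤slot : ∀ s x → roundUp s (kOf x) + lw x ≤ s + slot x
  roundUp+lw≤slot s x = begin
    roundUp s (kOf x) + lw x          ≤⟨ +-monoˡ-≤ (lw x) (roundUp-≤ s (kOf x)) ⟩
    s + (2 ^ kOf x ∸ 1) + lw x        ≡⟨ +-assoc s _ (lw x) ⟩
    s + ((2 ^ kOf x ∸ 1) + lw x)      ≡⟨ cong (_+_ s) (+-comm _ (lw x)) ⟩
    s + (lw x + (2 ^ kOf x ∸ 1))      ≡⟨ cong (_+_ s) (+-∸-assoc (lw x) (m^n>0 2 (kOf x))) ⟨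
    s + slot x                        ∎
    where open ≤-Reasoning

  module Frame {h m f} (s : ℕ) (e : Pos (node h m f) → Pos T) (E : Embeds e) where

    root : Pos T
    root = e here

    r : ℕ
    r = idIn (node h m f) s e here

    kid : Fin m → Pos T
    kid j = e (lt j here)

    cl : Fin m → ℕ
    cl j = wc (kid j)

    -- lo j is the start value that AssignId passes to light child j.
    base lo hi : Fin m → ℕ
    base j = r + A root (cl j ∸ 1) + 1
    lo   j = base j + before e j (cl j)
    hi   j = lo j + pw (kid j)

    cl≤wc : ∀ j → cl j ≤ wc root
    cl≤wc j = wc-light-⋖ (⋖-e E (par-lt j)) (apxIn-e E true (lt j here))

    r<lo : ∀ j → r < lo j
    r<lo j = ≤-trans (≤-reflexive (+-comm 1 r)) (≤-trans (+-monoˡ-≤ 1 (m≤m+n r _)) (m≤m+n (base j) _))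

    1≤cl : ∀ j → 1 ≤ cl j
    1≤cl j = m≤m⊔n 1 ⌊log₂ γ (kid j) ⌋

    b≡sumWhere : ∀ i → b root i ≡ sumWhere (λ j → pw (kid j)) (λ j → cl j ≟ i) (allFin m)
    b≡sumWhere i = begin
      sum (map pw (filter (λ v → wc v ≟ i) (lightKids root)))
        ≡⟨ cong (λ vs → sum (map pw (filter (λ v → wc v ≟ i) vs))) kids ⟩
      sum (map pw (filter (λ v → wc v ≟ i) (map kid (allFin m))))
        ≡⟨ cong (λ vs → sum (map pw vs)) (filter-map (λ v → wc v ≟ i) kid (allFin m)) ⟩
      sum (map pw (map kid (filter (λ j → cl j ≟ i) (allFin m))))
        ≡⟨ cong sum (map-∘ (filter (λ j → cl j ≟ i) (allFin m))) ⟨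
      sumWhere (λ j → pw (kid j)) (λ j → cl j ≟ i) (allFin m)
        ∎
      where
      open ≡-Reasoning
      kids : lightKids root ≡ map kid (allFin m)
      kids = trans (lightKids-e E here) (sym (map-∘ (allFin m)))

    before≡sumWhere : ∀ j i → before e j i ≡
                      sumWhere (λ j → pw (kid j))
                        ((λ j′ → toℕ j′ <? toℕ j) ∩? (λ j′ → cl j′ ≟ i)) (allFin m)
    before≡sumWhere j i = cong (λ js → sum (map (λ j → pw (kid j)) js)) (filter-filter _ _ (allFin m))

    before+pw≤b : ∀ j → before e j (cl j) + pw (kid j) ≤ b root (cl j)
    before+pw≤b j = begin
      before e j (cl j) + pw (kid j)
        ≡⟨ cong (_+ pw (kid j)) (before≡sumWhere j (cl j)) ⟩
      sumWhere _ ((λ j′ → toℕ j′ <? toℕ j) ∩? (λ j′ → cl j′ ≟ cl j)) (allFin m) + pw (kid j)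
        ≤⟨ sumWhere-+ _ _ _ proj₂ (∈-allFin j) (λ (j<j , _) → <-irrefl refl j<j) refl ⟩
      sumWhere _ (λ j′ → cl j′ ≟ cl j) (allFin m)
        ≡⟨ b≡sumWhere (cl j) ⟨
      b root (cl j)
        ∎
      where open ≤-Reasoning

    hi≤ : ∀ j → hi j ≤ suc (r + A root (cl j))
    hi≤ j = begin
      base j + before e j (cl j) + pw (kid j)          ≡⟨ +-assoc (base j) _ _ ⟩
      base j + (before e j (cl j) + pw (kid j))        ≤⟨ +-monoʳ-≤ (base j) (before+pw≤b j) ⟩
      r + A root (cl j ∸ 1) + 1 + b root (cl j)        ≡⟨ shuffle r _ _ ⟩
      suc (r + (A root (cl j ∸ 1) + b root (cl j)))
        ≤⟨ s≤s (+-monoʳ-≤ r (A-step root (cl j) (1≤cl j) (cl≤wc j))) ⟩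
      suc (r + A root (cl j))                          ∎
      where
      open ≤-Reasoning
      shuffle : ∀ x y z → x + y + 1 + z ≡ suc (x + (y + z))
      shuffle = solve-∀

    hi≤r+lw : ∀ j → hi j ≤ r + lw root
    hi≤r+lw j = ≤-trans (hi≤ j) (≤-trans (s≤s (+-monoʳ-≤ r (A-mono root (cl≤wc j) ≤-refl)))
                                           (≤-reflexive (sym (+-suc r _))))

    hi≤lo-higher-class : ∀ j j′ → cl j < cl j′ → hi j ≤ lo j′
    hi≤lo-higher-class j j′ cl<cl′ = begin
      hi j                            ≤⟨ hi≤ j ⟩
      suc (r + A root (cl j))
        ≤⟨ s≤s (+-monoʳ-≤ r (A-mono root (∸-monoˡ-≤ 1 cl<cl′) (≤-trans (m∸n≤m _ 1) (cl≤wc j′)))) ⟩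
      suc (r + A root (cl j′ ∸ 1))    ≡⟨ +-comm 1 _ ⟩
      base j′                         ≤⟨ m≤m+n _ _ ⟩
      lo j′                           ∎
      where open ≤-Reasoning

    hi≤lo-later : ∀ j j′ → cl j ≡ cl j′ → toℕ j < toℕ j′ → hi j ≤ lo j′
    hi≤lo-later j j′ cl≡cl′ j<j′ = begin
      base j + before e j (cl j) + pw (kid j)        ≡⟨ +-assoc (base j) _ _ ⟩
      base j + (before e j (cl j) + pw (kid j))      ≤⟨ +-monoʳ-≤ (base j) earlier+pw≤later ⟩
      base j + before e j′ (cl j)
        ≡⟨ cong (λ i → r + A root (i ∸ 1) + 1 + before e j′ i) cl≡cl′ ⟩
      lo j′                                          ∎
      where
      open ≤-Reasoning
      earlier+pw≤later : before e j (cl j) + pw (kid j) ≤ before e j′ (cl j)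
      earlier+pw≤later = begin
        before e j (cl j) + pw (kid j)  ≡⟨ cong (_+ pw (kid j)) (before≡sumWhere j (cl j)) ⟩
        _                               ≤⟨ sumWhere-+ _ _ _ (λ (x<j , c) → <-trans x<j j<j′ , c)
                                             (∈-allFin j) (λ (j<j , _) → <-irrefl refl j<j) (j<j′ , refl) ⟩
        _                               ≡⟨ before≡sumWhere j′ (cl j) ⟨
        before e j′ (cl j)              ∎

    separated : ∀ j j′ → j ≢ j′ → hi j ≤ lo j′ ⊎ hi j′ ≤ lo j
    separated j j′ j≢j′ with <-cmp (cl j) (cl j′)
    ... | tri< cl<cl′ _ _ = inj₁ (hi≤lo-higher-class j j′ cl<cl′)
    ... | tri> _ _ cl′<cl = inj₂ (hi≤lo-higher-class j′ j cl′<cl)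
    ... | tri≈ _ cl≡cl′ _ with <-cmp (toℕ j) (toℕ j′)
    ...   | tri< j<j′ _ _ = inj₁ (hi≤lo-later j j′ cl≡cl′ j<j′)
    ...   | tri> _ _ j′<j = inj₂ (hi≤lo-later j′ j (sym cl≡cl′) j′<j)
    ...   | tri≈ _ j≡j′ _ = contradiction (toℕ-injective j≡j′) j≢j′

  idIn-range : ∀ t s (e : Pos t → Pos T) → Embeds e → ∀ q →
               s ≤ idIn t s e q × idIn t s e q + lw (e q) ≤ s + pathSlots t e
  idIn-range t s e E here =
    roundUp-≥ s (kOf (e here)) , ≤-trans (roundUp+lw≤slot s (e here)) (+-monoʳ-≤ s (slot≤pathSlots t e))
  idIn-range (node h m f) s e E (hv q) =
    ≤-trans (roundUp-≥ s (kOf root)) (≤-trans (m≤m+n r (lw root)) (proj₁ IH)) , (begin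
      idIn h (r + lw root) e′ q + lw (e′ q)  ≤⟨ proj₂ IH ⟩
      r + lw root + pathSlots h e′           ≤⟨ +-monoˡ-≤ _ (roundUp+lw≤slot s root) ⟩
      s + slot root + pathSlots h e′         ≡⟨ +-assoc s _ _ ⟩
      s + (slot root + pathSlots h e′)       ≡⟨ cong (_+_ s) (pathSlots-node e) ⟨
      s + pathSlots (node h m f) e           ∎)
    where
    open Frame s e E
    open ≤-Reasoning
    e′ = λ q → e (hv q)
    IH = idIn-range h (r + lw root) e′ (embeds-∘ E embeds-hv) q
  idIn-range (node h m f) s e E (lt j q) =
    ≤-trans (roundUp-≥ s (kOf root)) (≤-trans (<⇒≤ (r<lo j)) (proj₁ IH)) , (begin
      idIn (f j) (lo j) e′ q + lw (e′ q)     ≤⟨ proj₂ IH ⟩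
      lo j + pathSlots (f j) e′              ≡⟨ cong (_+_ (lo j)) (pw≡pathSlots (embeds-∘ E (embeds-lt j))) ⟨
      hi j                                   ≤⟨ hi≤r+lw j ⟩
      r + lw root                            ≤⟨ roundUp+lw≤slot s root ⟩
      s + slot root                          ≤⟨ +-monoʳ-≤ s (slot≤pathSlots _ e) ⟩
      s + pathSlots (node h m f) e           ∎)
    where
    open Frame s e E
    open ≤-Reasoning
    e′ = λ q → e (lt j q)
    IH = idIn-range (f j) (lo j) e′ (embeds-∘ E (embeds-lt j)) q

  module FrameOrder {h m f} (s : ℕ) (e : Pos (node h m f) → Pos T) (E : Embeds e) where
    open Frame s e E

    idN : Pos (node h m f) → ℕ
    idN = idIn (node h m f) s e

    end : Pos (node h m f) → ℕ
    end q = idN q + lw (e q)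

    id<end : ∀ q → idN q < end q
    id<end q = m<m+n (idN q) (s≤s z≤n)

    lt-range : ∀ j q → lo j ≤ idN (lt j q) × end (lt j q) ≤ hi j
    lt-range j q = proj₁ IH , ≤-trans (proj₂ IH) (≤-reflexive (cong (_+_ (lo j)) (sym (pw≡pathSlots E′))))
      where
      E′ = embeds-∘ E (embeds-lt j)
      IH = idIn-range (f j) (lo j) (λ q → e (lt j q)) E′ q

    end-here≤hv : ∀ q → end here ≤ idN (hv q)
    end-here≤hv q = proj₁ (idIn-range h (r + lw root) (λ q → e (hv q)) (embeds-∘ E embeds-hv) q)

    here<hv : ∀ q → idN here < idN (hv q)
    here<hv q = <-≤-trans (id<end here) (end-here≤hv q)

    here<lt : ∀ j q → idN here < idN (lt j q)
    here<lt j q = <-≤-trans (r<lo j) (proj₁ (lt-range j q))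

    end-lt≤hv : ∀ j q q′ → end (lt j q) ≤ idN (hv q′)
    end-lt≤hv j q q′ = ≤-trans (proj₂ (lt-range j q)) (≤-trans (hi≤r+lw j) (end-here≤hv q′))

    lt-apart : ∀ j j′ q q′ → j ≢ j′ →
               end (lt j q) ≤ idN (lt j′ q′) ⊎ end (lt j′ q′) ≤ idN (lt j q)
    lt-apart j j′ q q′ j≢j′ = Sum.map (before-lt q q′) (before-lt q′ q) (separated j j′ j≢j′)
      where
      before-lt : ∀ {j j′} q q′ → hi j ≤ lo j′ → end (lt j q) ≤ idN (lt j′ q′)
      before-lt q q′ hi≤lo′ = ≤-trans (proj₂ (lt-range _ q)) (≤-trans hi≤lo′ (proj₁ (lt-range _ q′)))

  LightDescendant : ∀ {t} → (Pos t → Pos T) → Pos t → Pos t → Set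
  LightDescendant e u v = ∃ λ w → u ⋖ w × apx (e w) ≡ true × w ⋖* v

  idIn-block-members : ∀ t s (e : Pos t → Pos T) → Embeds e → ∀ u v →
                  idIn t s e u ≤ idIn t s e v → idIn t s e v < idIn t s e u + lw (e u) →
                  v ≡ u ⊎ LightDescendant e u v
  idIn-block-members t s e E here here _ _ = inj₁ refl
  idIn-block-members (node h m f) s e E here (hv q) _ v<end =
    ⊥-elim (<⇒≱ v<end (FrameOrder.end-here≤hv s e E q))
  idIn-block-members (node h m f) s e E here (lt j q) _ _ =
    inj₂ (lt j here , par-lt j , apxIn-e E true (lt j here) , ⋖*-map (lt j) (in-lt j) (here-⋖* q))
  idIn-block-members (node h m f) s e E (hv u) here u≤v _ =
    ⊥-elim (<⇒≱ (FrameOrder.here<hv s e E u) u≤v)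
  idIn-block-members (node h m f) s e E (hv u) (hv q) u≤v v<end =
    Sum.map (cong hv) (λ (w , uw , aw , wq) → hv w , in-hv uw , aw , ⋖*-map hv in-hv wq)
      (idIn-block-members h _ _ (embeds-∘ E embeds-hv) u q u≤v v<end)
  idIn-block-members (node h m f) s e E (hv u) (lt j q) u≤v _ =
    ⊥-elim (<⇒≱ (<-≤-trans (FrameOrder.id<end s e E (lt j q)) (FrameOrder.end-lt≤hv s e E j q u)) u≤v)
  idIn-block-members (node h m f) s e E (lt j u) here u≤v _ =
    ⊥-elim (<⇒≱ (FrameOrder.here<lt s e E j u) u≤v)
  idIn-block-members (node h m f) s e E (lt j u) (hv q) _ v<end =
    ⊥-elim (<⇒≱ v<end (FrameOrder.end-lt≤hv s e E j u q))
  idIn-block-members (node h m f) s e E (lt j u) (lt j′ q) u≤v v<end with j Fin.≟ j′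
  ... | yes refl =
    Sum.map (cong (lt j)) (λ (w , uw , aw , wq) → lt j w , in-lt j uw , aw , ⋖*-map (lt j) (in-lt j) wq)
      (idIn-block-members (f j) _ _ (embeds-∘ E (embeds-lt j)) u q u≤v v<end)
  ... | no j≢j′ with FrameOrder.lt-apart s e E j j′ u q j≢j′
  ...   | inj₁ end≤v = ⊥-elim (<⇒≱ v<end end≤v)
  ...   | inj₂ end′≤u = ⊥-elim (<⇒≱ (<-≤-trans (FrameOrder.id<end s e E (lt j′ q)) end′≤u) u≤v)

  idIn-light-subtree : ∀ t s (e : Pos t → Pos T) → Embeds e →
                       ∀ {u w v} → u ⋖ w → apx (e w) ≡ true → w ⋖* v →
                       idIn t s e u + A (e u) (wc (e w) ∸ 1) < idIn t s e v ×
                       idIn t s e v ≤ idIn t s e u + A (e u) (wc (e w))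
  idIn-light-subtree (node h m f) s e E par-hv aw _ =
    contradiction (trans (sym (apxIn-e E true (hv here))) aw) λ ()
  idIn-light-subtree (node h m f) s e E (par-lt j) _ wv with lt-⋖*⁻¹ wv
  ... | q , refl , _ =
      ≤-trans (≤-reflexive (+-comm 1 _)) (≤-trans (m≤m+n (base j) _) (proj₁ (lt-range j q)))
    , s≤s⁻¹ (≤-trans (<-≤-trans (id<end (lt j q)) (proj₂ (lt-range j q))) (hi≤ j))
    where
    open Frame s e E
    open FrameOrder s e E
  idIn-light-subtree (node h m f) s e E (in-hv uw) aw wv with hv-⋖*⁻¹ wv
  ... | _ , refl , wv′ = idIn-light-subtree h _ _ (embeds-∘ E embeds-hv) uw aw wv′
  idIn-light-subtree (node h m f) s e E (in-lt j uw) aw wv with lt-⋖*⁻¹ wv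
  ... | _ , refl , wv′ = idIn-light-subtree (f j) _ _ (embeds-∘ E (embeds-lt j)) uw aw wv′

  idIn-⋖ₕ : ∀ {t} {u v : Pos t} → u ⋖ₕ v → ∀ s e →
            idIn t s e v ≡ roundUp (idIn t s e u + lw (e u)) (kOf (e v))
  idIn-⋖ₕ hv-here      s e = refl
  idIn-⋖ₕ (hv-hv uv)   s e = idIn-⋖ₕ uv _ _
  idIn-⋖ₕ (hv-lt j uv) s e = idIn-⋖ₕ uv _ _

  block-members : ∀ u v → id u ≤ id v → id v < id u + lw u → v ≡ u ⊎ LightDescendant (λ q → q) u v
  block-members = idIn-block-members T 0 (λ q → q) embeds-id

  light-subtree-ids : ∀ {u w v} → u ⋖ w → apx w ≡ true → w ⋖* v →
                      id u + A u (wc w ∸ 1) < id v × id v ≤ id u + A u (wc w)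
  light-subtree-ids = idIn-light-subtree T 0 (λ q → q) embeds-id

  id-injective : ∀ u v → id u ≡ id v → u ≡ v
  id-injective u v idu≡idv
    with block-members u v (≤-reflexive idu≡idv)
           (≤-<-trans (≤-reflexive (sym idu≡idv)) (m<m+n (id u) (s≤s z≤n)))
  ... | inj₁ v≡u = sym v≡u
  ... | inj₂ (w , uw , aw , wv) =
    ⊥-elim (<-irrefl idu≡idv (≤-<-trans (m≤m+n (id u) _) (proj₁ (light-subtree-ids uw aw wv))))

  HeavyChildCond LightChildCond : Pos T → Pos T → Set
  HeavyChildCond u v = (apx v ≡ false) × (heavyKid u ≢ [])
                       × SmallestTZ (id v) (id u + lw u) ∣ + kOf u +ℤ next u ∣
  LightChildCond u v = (apx v ≡ true) × (wc v ≤ wc u)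
                       × (id u + A u (wc v ∸ 1) < id v × id v ≤ id u + A u (wc v))
                       × ((wc v < wc u → rld v ≡ 0) × (wc v ≡ wc u → rld v ≡ rld u + 1))

  id-⋖ₕ-smallest : ∀ {u v} → u ⋖ₕ v → SmallestTZ (id v) (id u + lw u) ∣ + kOf u +ℤ next u ∣
  id-⋖ₕ-smallest {u} {v} uv
    rewrite heavyKid-⋖ₕ uv | i+[j-i]≡j (+ kOf u) (+ kOf v) | idIn-⋖ₕ uv 0 (λ q → q) =
    roundUp-smallest (id u + lw u) (kOf v)

  heavy-child-cond : ∀ {u v} → u ⋖ v → apx v ≡ false → HeavyChildCond u v
  heavy-child-cond uv av =
    av , (λ kid≡[] → contradiction (trans (sym (heavyKid-⋖ₕ uv′)) kid≡[]) λ ()) , id-⋖ₕ-smallest uv′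
    where uv′ = ⋖⇒⋖ₕ true uv av

  heavy-child-cond⁻¹ : ∀ {u v} → HeavyChildCond u v → u ⋖ v
  heavy-child-cond⁻¹ {u} {v} (_ , kid≢[] , smallest) with heavyKid-[]⊎⋖ₕ u
  ... | inj₁ kid≡[]   = contradiction kid≡[] kid≢[]
  ... | inj₂ (w , uw) =
    subst (u ⋖_) (sym (id-injective v w id-v≡id-w)) (⋖ₕ⇒⋖ uw)
    where
    id-v≡id-w : id v ≡ id w
    id-v≡id-w = SmallestTZ-unique {x = id u + lw u} {n = ∣ + kOf u +ℤ next u ∣} smallest (id-⋖ₕ-smallest uw)

  light-child-cond : ∀ {u v} → u ⋖ v → apx v ≡ true → LightChildCond u v
  light-child-cond uv av =
    av , wc-light-⋖ uv av , light-subtree-ids uv av ε , rld-light-⋖ uv av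

  light-child-cond⁻¹ : ∀ {u v} → LightChildCond u v → u ⋖ v
  light-child-cond⁻¹ {u} {v} (av , wcv≤wcu , (above , below) , reset , step) =
    from-block (block-members u v (<⇒≤ u<v) v<end)
    where
    u<v : id u < id v
    u<v = ≤-<-trans (m≤m+n (id u) _) above
    v<end : id v < id u + lw u
    v<end = ≤-trans (s≤s (≤-trans below (+-monoʳ-≤ (id u) (A-mono u wcv≤wcu ≤-refl))))
                    (≤-reflexive (sym (+-suc _ _)))
    from-block : v ≡ u ⊎ LightDescendant (λ q → q) u v → u ⋖ v
    from-block (inj₁ v≡u)                  = ⊥-elim (<-irrefl (cong id (sym v≡u)) u<v)
    from-block (inj₂ (w , uw , aw , ε))      = uw
    from-block (inj₂ (w , uw , aw , wy ▸ yv)) =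
      ⊥-elim (rld-light-descendant uw aw wy yv av wcv≡wcw reset step)
      where
      blockW = light-subtree-ids uw aw (wy ▸ yv)
      wcv≡wcw : wc v ≡ wc w
      wcv≡wcw = interval-unique (λ i≤j j≤n → +-monoʳ-≤ (id u) (A-mono u i≤j j≤n)) wcv≤wcu (wc-light-⋖ uw aw)
                  above below (proj₁ blockW) (proj₂ blockW)

lemma8 : (T : HTree) → HLD T → (A : Pos T → ℕ → ℕ) → ValidA T A →
    (u v : Pos T) →
    let open Weights A
        open Ids A
        cond1 = (apx v ≡ false) × (heavyKid u ≢ [])
                × SmallestTZ (id v) (id u + lw u) ∣ + kOf u +ℤ next u ∣
        cond2 = (apx v ≡ true) × (wc v ≤ wc u)
                × (id u + A u (wc v ∸ 1) < id v × id v ≤ id u + A u (wc v))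
                × ((wc v < wc u → rld v ≡ 0) × (wc v ≡ wc u → rld v ≡ rld u + 1))
    in (u ⋖ v → cond1 ⊎ cond2) × (cond1 ⊎ cond2 → u ⋖ v)
lemma8 T _ A VA u v = forward , Sum.[ heavy-child-cond⁻¹ , light-child-cond⁻¹ ]
  where
  open Layout A VA
  forward : u ⋖ v → HeavyChildCond u v ⊎ LightChildCond u v
  forward uv = by-apex (apx v) refl
    where
    by-apex : ∀ b → apx v ≡ b → HeavyChildCond u v ⊎ LightChildCond u v
    by-apex false av = inj₁ (heavy-child-cond uv av)
    by-apex true  av = inj₂ (light-child-cond uv av)
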